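{- Let $\Gamma=(\mathcal{P},\mathcal{L},\mathtt{I})$ be a finite weak generalised $2m$-gon of order $(s,t)$, $m\ge2$, and $\mathbb{F}$ a field. For every $\mathfrak{c}\in\mathfrak{C}_{\mathbb{F}}$ and all points $v,w$, $\langle\mathfrak{c},\mathfrak{c}_v\rangle=\langle\mathfrak{c},\mathfrak{c}_w\rangle$.
   Context: A weak generalised $n$-gon ($n\ge3$) is a point-line geometry (points, lines, symmetric incidence) with no ordinary $k$-gon as subgeometry for $2\le k<n$ and in which any two elements lie in a common ordinary $n$-gon; distance is in the bipartite incidence graph. Order $(s,t)$: each line has $s+1$ points, each point on $t+1$ lines. $\mathcal{P}_i(v)$ is the set of points at distance exactly $i$ from $v$. Integers are interpreted in $\mathbb{F}$ via $k\mapsto k\cdot1_{\mathbb{F}}$. $\mathbb{F}\mathcal{P}$: functions $\mathcal{P}\to\mathbb{F}$, $\langle\mathfrak{f},\mathfrak{g}\rangle=\sum_x\mathfrak{f}(x)\mathfrak{g}(x)$; $\mathfrak{i}_S$ indicator of $S$; $\mathfrak{i}_L$ indicator of the point set of line $L$. $\mathfrak{C}_{\mathbb{F}}$ is the span of $\{\mathfrak{i}_L:L\in\mathcal{L}\}$. For a point $v$, $\mathfrak{c}_v=\sum_{k=0}^{m-1}\big(\sum_{j=0}^{m-k-1}(-s)^j\big)\mathfrak{i}_{\mathcal{P}_{2k}(v)}$. -}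

module Defs where

open import Level using (Level; _⊔_)
open import Data.Nat using (ℕ; zero; suc; _<_; _≤_)
import Data.Nat as ℕ
open import Data.Fin using (Fin; toℕ)
open import Data.Bool using (Bool; true; false; _∧_; _∨_; not; if_then_else_)
open import Data.Sum using (_⊎_; inj₁; inj₂)
open import Data.Product using (Σ; _×_; _,_; ∃)
open import Data.Vec.Functional using (foldr)
open import Function.Definitions using (Injective)
open import Relation.Nullary using (¬_)
open import Data.Empty using (⊥)
open import Data.Fin using (_≟_)
open import Relation.Nullary.Decidable using (⌊_⌋)
open import Relation.Binary.PropositionalEquality using (_≡_)
open import Algebra.Bundles using (CommutativeRing)

record IsField {c ℓ : Level} (R : CommutativeRing c ℓ) : Set (c ⊔ ℓ) where
  open CommutativeRing R
  field
    1≉0     : ¬ (1# ≈ 0#)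
    inverse : ∀ x → ¬ (x ≈ 0#) → Σ Carrier (λ y → (x * y) ≈ 1#)

record Geometry : Set where
  field
    np : ℕ
    nl : ℕ
    I  : Fin np → Fin nl → Bool

count : {n : ℕ} → (Fin n → Bool) → ℕ
count p = foldr (λ b k → if b then suc k else k) 0 p

anyFin : {n : ℕ} → (Fin n → Bool) → Bool
anyFin p = foldr _∨_ false p

module _ (Γ : Geometry) where
  open Geometry Γ

  Elem : Set
  Elem = Fin np ⊎ Fin nl

  Adj : Elem → Elem → Set
  Adj (inj₁ x) (inj₂ L) = I x L ≡ true
  Adj (inj₂ L) (inj₁ x) = I x L ≡ true
  Adj (inj₁ _) (inj₁ _) = ⊥
  Adj (inj₂ _) (inj₂ _) = ⊥

  record OrdinaryGon (k : ℕ) : Set where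
    field
      vert   : Fin (2 ℕ.* k) → Elem
      inj    : Injective _≡_ _≡_ vert
      adjac  : ∀ (i j : Fin (2 ℕ.* k)) → suc (toℕ i) ≡ toℕ j → Adj (vert i) (vert j)
      closes : ∀ (i j : Fin (2 ℕ.* k)) → suc (toℕ i) ≡ 2 ℕ.* k → toℕ j ≡ 0 → Adj (vert i) (vert j)

  record IsWeakGenPolygon (n : ℕ) : Set where
    field
      n≥3       : 3 ≤ n
      noSmall   : ∀ k → 2 ≤ k → k < n → ¬ (OrdinaryGon k)
      inCommon  : ∀ (a b : Elem) →
                  Σ (OrdinaryGon n) (λ g →
                    Σ (Fin (2 ℕ.* n)) (λ i → Σ (Fin (2 ℕ.* n)) (λ j →
                      (OrdinaryGon.vert g i ≡ a) × (OrdinaryGon.vert g j ≡ b))))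

  HasOrder : ℕ → ℕ → Set
  HasOrder s t = (∀ L → count (λ x → I x L) ≡ suc s)
               × (∀ x → count (λ L → I x L) ≡ suc t)

  -- within k v x : the points v and x are at distance ≤ 2k in the
  -- incidence graph (point-point distances are even).
  within : ℕ → Fin np → Fin np → Bool
  within zero    v x = ⌊ v ≟ x ⌋
  within (suc k) v x =
    within k v x ∨ anyFin (λ L → I x L ∧ anyFin (λ y → within k v y ∧ I y L))

  atDist2 : ℕ → Fin np → Fin np → Bool
  atDist2 zero    v x = within zero v x
  atDist2 (suc k) v x = within (suc k) v x ∧ not (within k v x)

module Code {c ℓ : Level} (R : CommutativeRing c ℓ) (Γ : Geometry) where
  open CommutativeRing R
  open Geometry Γ

  ∑ : {n : ℕ} → (Fin n → Carrier) → Carrier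
  ∑ f = foldr _+_ 0# f

  ∑< : ℕ → (ℕ → Carrier) → Carrier
  ∑< zero    f = 0#
  ∑< (suc n) f = ∑< n f + f n

  ι : ℕ → Carrier
  ι zero    = 0#
  ι (suc k) = 1# + ι k

  pow : Carrier → ℕ → Carrier
  pow a zero    = 1#
  pow a (suc j) = a * pow a j

  𝕚 : {n : ℕ} → (Fin n → Bool) → Fin n → Carrier
  𝕚 p x = if p x then 1# else 0#

  ⟨_,_⟩ : (Fin np → Carrier) → (Fin np → Carrier) → Carrier
  ⟨ f , g ⟩ = ∑ (λ x → f x * g x)

  𝕚L : Fin nl → Fin np → Carrier
  𝕚L L = 𝕚 (λ x → I x L)

  InCode : (Fin np → Carrier) → Set (c ⊔ ℓ)
  InCode f = Σ (Fin nl → Carrier) (λ a → ∀ x → f x ≈ ∑ (λ L → a L * 𝕚L L x))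

  cvec : (m s : ℕ) → Fin np → Fin np → Carrier
  cvec m s v x =
    ∑< m (λ k → ∑< (m ℕ.∸ k) (λ j → pow (- ι s) j) * 𝕚 (atDist2 Γ k v) x)

{-# OPTIONS --safe #-}
-- Every line L has a unique point p nearest to v: if L is at distance 2k + 1 from v, then p is at
-- distance 2k with k < m and the other s points of L are at distance 2k + 2, because two nearest
-- points, joined back to v by geodesics, would close up into an ordinary gon with at most
-- 2k + 1 < 2m sides.  The coefficient A_k = Σ_{j < m-k} (-s)^j of 𝔦_{𝒫_{2k}(v)} in 𝔠_v (which is
-- 0 for k ≥ m) satisfies A_k = 1 - s A_{k+1} for k < m, so ⟨𝔦_L, 𝔠_v⟩ = A_k + s A_{k+1} = 1.
-- By linearity ⟨𝔠, 𝔠_v⟩ is then the sum of the coefficients of 𝔠 in the line indicators,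
-- whatever v is.
module Submission where

open import Defs
open import Level using (Level)
open import Data.Nat using (ℕ; _≤_)
open import Data.Fin using (Fin)
open import Algebra.Bundles using (CommutativeRing)

open import Data.Bool using (Bool; true; false; _∧_; _∨_; not; if_then_else_)
open import Data.Bool.Properties as Boolₚ
  using (∨-zeroʳ; ∧-zeroʳ; ∧-conicalˡ; ∧-conicalʳ; ¬-not; T-≡)
open import Data.Empty using (⊥; ⊥-elim)
open import Data.Fin using (toℕ; fromℕ<; punchIn)
import Data.Fin.Properties as Finₚ
open import Data.Nat as ℕ using (zero; suc; _∸_; _<_; _≤?_; z≤n; s≤s; s≤s⁻¹)
import Data.Nat.Properties as ℕₚ
open import Data.Nat.Tactic.RingSolver using (solve-∀)
open import Data.Product using (_×_; _,_; proj₁; proj₂; ∃; ∃₂)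
open import Data.Sum using (_⊎_; inj₁; inj₂)
open import Data.Sum.Properties using (≡-dec; inj₁-injective)
open import Data.Vec.Functional using (removeAt)
open import Function using (_∘_)
open import Function.Bundles using (Equivalence)
open import Relation.Binary.Bundles using (Setoid)
open import Relation.Binary.Definitions using (tri<; tri≈; tri>)
open import Relation.Binary.PropositionalEquality
  using (_≡_; _≢_; refl; sym; trans; cong; cong₂; subst; subst₂)
open import Relation.Nullary using (¬_; yes; no)
open import Relation.Nullary.Decidable using (toWitness; fromWitness; _×-dec_)
open import Relation.Unary using (Decidable)

∨-true⁻ : ∀ a {b} → a ∨ b ≡ true → a ≡ true ⊎ b ≡ true
∨-true⁻ true  _ = inj₁ refl
∨-true⁻ false e = inj₂ e

∨-trueˡ : ∀ {a} b → a ≡ true → a ∨ b ≡ true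
∨-trueˡ b refl = refl

∨-trueʳ : ∀ a {b} → b ≡ true → a ∨ b ≡ true
∨-trueʳ a refl = ∨-zeroʳ a

anyFin-true⁻ : ∀ {n} (p : Fin n → Bool) → anyFin p ≡ true → ∃ λ i → p i ≡ true
anyFin-true⁻ {suc n} p e with ∨-true⁻ (p Fin.zero) e
... | inj₁ p₀ = Fin.zero , p₀
... | inj₂ ps with anyFin-true⁻ (p ∘ Fin.suc) ps
...   | i , pᵢ = Fin.suc i , pᵢ

anyFin-true⁺ : ∀ {n} (p : Fin n → Bool) i → p i ≡ true → anyFin p ≡ true
anyFin-true⁺ p Fin.zero    e = ∨-trueˡ _ e
anyFin-true⁺ p (Fin.suc i) e = ∨-trueʳ (p Fin.zero) (anyFin-true⁺ (p ∘ Fin.suc) i e)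

2*suc : ∀ n → 2 ℕ.* suc n ≡ suc (suc (n ℕ.+ n))
2*suc = solve-∀

module _ {p} {P : ℕ → Set p} where
  open import Data.Nat using (_+_)

  Least : ℕ → Set p
  Least k = P k × (∀ {j} → j < k → ¬ P j)

  least-unique : ∀ {k k′} → Least k → Least k′ → k ≡ k′
  least-unique {k} {k′} (pk , below) (pk′ , below′) with ℕₚ.<-cmp k k′
  ... | tri< k<k′ _ _ = ⊥-elim (below′ k<k′ pk)
  ... | tri≈ _ k≡k′ _ = k≡k′
  ... | tri> _ _ k′<k = ⊥-elim (below k′<k pk′)

  least-witness : Decidable P → ∀ {K} → P K → ∃ λ k → k ≤ K × Least k
  least-witness P? {K} pK = search 0 K refl (λ ())
    where
      search : ∀ i d → i + d ≡ K → (∀ {j} → j < i → ¬ P j) → ∃ λ k → k ≤ K × Least k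
      search i d i+d≡K below with P? i
      ... | yes pᵢ = i , subst (i ≤_) i+d≡K (ℕₚ.m≤m+n i d) , pᵢ , below
      search i zero    i+d≡K below | no ¬pᵢ =
        ⊥-elim (¬pᵢ (subst P (trans (sym i+d≡K) (ℕₚ.+-identityʳ i)) pK))
      search i (suc d) i+d≡K below | no ¬pᵢ =
        search (suc i) d (trans (sym (ℕₚ.+-suc i d)) i+d≡K) below′
        where
          below′ : ∀ {j} → j < suc i → ¬ P j
          below′ j<1+i with ℕₚ.m≤n⇒m<n∨m≡n (s≤s⁻¹ j<1+i)
          ... | inj₁ j<i  = below j<i
          ... | inj₂ refl = ¬pᵢ

module IncidenceGraph (Γ : Geometry) where
  open import Data.Nat using (_+_; _*_)
  open Geometry Γ

  Adj-sym : ∀ {a b} → Adj Γ a b → Adj Γ b a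
  Adj-sym {inj₁ _} {inj₂ _} e = e
  Adj-sym {inj₂ _} {inj₁ _} e = e

  infixl 5 _▷_
  infixr 5 _◁_

  data Walk : ℕ → Elem Γ → Elem Γ → Set where
    []  : ∀ {a} → Walk 0 a a
    _▷_ : ∀ {n a b c} → Walk n a b → Adj Γ b c → Walk (suc n) a c

  _◁_ : ∀ {n a b c} → Adj Γ a b → Walk n b c → Walk (suc n) a c
  e ◁ []      = [] ▷ e
  e ◁ (w ▷ f) = (e ◁ w) ▷ f

  _++ʷ_ : ∀ {n n′ a b c} → Walk n a b → Walk n′ b c → Walk (n′ + n) a c
  w ++ʷ []      = w
  w ++ʷ (u ▷ e) = (w ++ʷ u) ▷ e

  reverse : ∀ {n a b} → Walk n a b → Walk n b a
  reverse []      = []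
  reverse (w ▷ e) = Adj-sym e ◁ reverse w

  shorter-walk : ∀ {k d d′ a b} → d + d′ ≡ k + k → Walk d a b → Walk d′ b a →
                 ∃ λ n → n ≤ k × Walk n a b
  shorter-walk {k} {d} {d′} d+d′≡2k w w′ with d ≤? k
  ... | yes d≤k = d , d≤k , w
  ... | no  d≰k = d′ , d′≤k , reverse w′
    where
      d′≤k : d′ ≤ k
      d′≤k = ℕₚ.+-cancelˡ-≤ k d′ k
               (ℕₚ.≤-trans (ℕₚ.+-monoˡ-≤ d′ (ℕₚ.<⇒≤ (ℕₚ.≰⇒> d≰k))) (ℕₚ.≤-reflexive d+d′≡2k))

  module _ {k} (g : OrdinaryGon Γ k) where
    open OrdinaryGon g

    walk-forward : ∀ t {i j : Fin (2 * k)} → toℕ i + t ≡ toℕ j → Walk t (vert i) (vert j)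
    walk-forward zero {i} i+0≡j =
      subst (Walk 0 (vert i) ∘ vert) (Finₚ.toℕ-injective (trans (sym (ℕₚ.+-identityʳ _)) i+0≡j)) []
    walk-forward (suc t) {i} {j} i+t+1≡j =
      walk-forward t (sym (Finₚ.toℕ-fromℕ< i+t<2k)) ▷
      adjac _ j (trans (cong suc (Finₚ.toℕ-fromℕ< i+t<2k)) (trans (sym (ℕₚ.+-suc _ t)) i+t+1≡j))
      where
        i+t<2k : toℕ i + t < 2 * k
        i+t<2k = ℕₚ.<-trans (subst (toℕ i + t <_) i+t+1≡j (ℕₚ.+-monoʳ-< (toℕ i) (ℕₚ.n<1+n t)))
                            (Finₚ.toℕ<n j)

    walk-around : ∀ e {i} j → suc (toℕ i + e) ≡ 2 * k → Walk (toℕ j + suc e) (vert i) (vert j)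
    walk-around e {i} j i+e+1≡2k =
      (walk-forward e (sym (Finₚ.toℕ-fromℕ< i+e<2k)) ▷
       closes _ first (trans (cong suc (Finₚ.toℕ-fromℕ< i+e<2k)) i+e+1≡2k) (Finₚ.toℕ-fromℕ< 0<2k))
      ++ʷ walk-forward (toℕ j) (cong (_+ toℕ j) (Finₚ.toℕ-fromℕ< 0<2k))
      where
        i+e<2k : toℕ i + e < 2 * k
        i+e<2k = ℕₚ.≤-reflexive i+e+1≡2k
        0<2k : 0 < 2 * k
        0<2k = ℕₚ.≤-trans (s≤s z≤n) (Finₚ.toℕ<n i)
        first : Fin (2 * k)
        first = fromℕ< 0<2k

    walk-both-ways : ∀ i j → toℕ i ≤ toℕ j →
      ∃₂ λ d d′ → d + d′ ≡ k + k × Walk d (vert i) (vert j) × Walk d′ (vert j) (vert i)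
    walk-both-ways i j i≤j with ℕₚ.m≤n⇒∃[o]m+o≡n i≤j | ℕₚ.m≤n⇒∃[o]m+o≡n (Finₚ.toℕ<n j)
    ... | d , i+d≡j | e , j+1+e≡2k =
      d , toℕ i + suc e , d+d′≡2k , walk-forward d i+d≡j , walk-around e i j+1+e≡2k
      where
        reassoc : ∀ d a e → d + (a + suc e) ≡ suc ((a + d) + e)
        reassoc = solve-∀
        d+d′≡2k : d + (toℕ i + suc e) ≡ k + k
        d+d′≡2k = trans (reassoc d (toℕ i) e)
                        (trans (cong (λ z → suc (z + e)) i+d≡j)
                               (trans j+1+e≡2k (cong (k +_) (ℕₚ.+-identityʳ k))))

    walk-≤ : ∀ i j → ∃ λ n → n ≤ k × Walk n (vert i) (vert j)
    walk-≤ i j with ℕₚ.≤-total (toℕ i) (toℕ j)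
    ... | inj₁ i≤j with walk-both-ways i j i≤j
    ...   | d , d′ , d+d′≡2k , w , w′ = shorter-walk d+d′≡2k w w′
    walk-≤ i j | inj₂ j≤i with walk-both-ways j i j≤i
    ...   | d , d′ , d+d′≡2k , w , w′ = shorter-walk (trans (ℕₚ.+-comm d′ d) d+d′≡2k) w′ w

  ordinaryGon : ∀ k (f : ℕ → Elem Γ) →
    (∀ {p q} → p < 2 * k → q < 2 * k → f p ≡ f q → p ≡ q) →
    (∀ {p} → suc p < 2 * k → Adj Γ (f p) (f (suc p))) →
    (∀ {p} → suc p ≡ 2 * k → Adj Γ (f p) (f 0)) →
    OrdinaryGon Γ k
  ordinaryGon k f f-inj f-adj f-closes = record
    { vert   = f ∘ toℕ
    ; inj    = λ {i} {j} → Finₚ.toℕ-injective ∘ f-inj (Finₚ.toℕ<n i) (Finₚ.toℕ<n j)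
    ; adjac  = λ i j i+1≡j → subst (Adj Γ (f (toℕ i)) ∘ f) i+1≡j
                                   (f-adj (subst (_< 2 * k) (sym i+1≡j) (Finₚ.toℕ<n j)))
    ; closes = λ i j i+1≡2k j≡0 → subst (Adj Γ (f (toℕ i)) ∘ f) (sym j≡0) (f-closes i+1≡2k)
    }

module Distances (Γ : Geometry) (v : Fin (Geometry.np Γ)) where
  open import Data.Nat using (_+_; _*_)
  open Geometry Γ
  open IncidenceGraph Γ

  Within : ℕ → Fin np → Set
  Within k x = within Γ k v x ≡ true

  LineWithin : ℕ → Fin nl → Set
  LineWithin k L = ∃ λ y → I y L ≡ true × Within k y

  within-refl : ∀ k → Within k v
  within-refl zero    = Equivalence.to T-≡ (fromWitness refl)
  within-refl (suc k) = ∨-trueˡ _ (within-refl k)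

  within-zero⁻ : ∀ {x} → Within 0 x → v ≡ x
  within-zero⁻ x-within = toWitness (Equivalence.from T-≡ x-within)

  within-mono : ∀ {j k x} → j ≤ k → Within j x → Within k x
  within-mono {k = zero}  z≤n   x-within = x-within
  within-mono {k = suc k} j≤1+k x-within with ℕₚ.m≤n⇒m<n∨m≡n j≤1+k
  ... | inj₁ j<1+k = ∨-trueˡ _ (within-mono (s≤s⁻¹ j<1+k) x-within)
  ... | inj₂ refl  = x-within

  within-step : ∀ k {x L} → I x L ≡ true → LineWithin k L → Within (suc k) x
  within-step k {x} {L} x∈L (y , y∈L , y-within) =
    ∨-trueʳ (within Γ k v x)
      (anyFin-true⁺ _ L (cong₂ _∧_ x∈L (anyFin-true⁺ _ y (cong₂ _∧_ y-within y∈L))))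

  within-suc⁻ : ∀ {k x} → Within (suc k) x →
                Within k x ⊎ ∃ λ L → I x L ≡ true × LineWithin k L
  within-suc⁻ {k} {x} x-within with ∨-true⁻ (within Γ k v x) x-within
  ... | inj₁ x-within-k = inj₁ x-within-k
  ... | inj₂ x-near with anyFin-true⁻ _ x-near
  ...   | L , x∈L∧L-near with anyFin-true⁻ _ (∧-conicalʳ (I x L) _ x∈L∧L-near)
  ...     | y , y-within∧y∈L =
    inj₂ (L , ∧-conicalˡ _ _ x∈L∧L-near , y ,
          ∧-conicalʳ (within Γ k v y) _ y-within∧y∈L , ∧-conicalˡ _ (I y L) y-within∧y∈L)

  lineWithin? : ∀ L → Decidable (λ k → LineWithin k L)
  lineWithin? L k = Finₚ.any? (λ y → (I y L Boolₚ.≟ true) ×-dec (within Γ k v y Boolₚ.≟ true))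

  Near : ℕ → Elem Γ → Set
  Near n (inj₁ x) = ∀ k → n ≤ suc (k + k) → Within k x
  Near n (inj₂ L) = ∀ k → n ≤ suc (suc (k + k)) → LineWithin k L

  walk⇒near : ∀ {n e} → Walk n (inj₁ v) e → Near n e
  walk⇒near [] k _ = within-refl k
  walk⇒near (_▷_ {b = inj₁ y} {c = inj₂ L} w y∈L) k n+1≤2k+2 =
    y , y∈L , walk⇒near w k (s≤s⁻¹ n+1≤2k+2)
  walk⇒near (_▷_ {b = inj₂ L} {c = inj₁ x} () x∈L) zero (s≤s z≤n)
  walk⇒near (_▷_ {n} {b = inj₂ L} {c = inj₁ x} w x∈L) (suc k) n+1≤2k+3 =
    within-step k x∈L (walk⇒near w k (subst (λ z → n ≤ suc z) (ℕₚ.+-suc k k) (s≤s⁻¹ n+1≤2k+3)))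

  line-within : ∀ {m} → IsWeakGenPolygon Γ (2 * suc m) → ∀ L → LineWithin m L
  line-within {m} polygon L with IsWeakGenPolygon.inCommon polygon (inj₁ v) (inj₂ L)
  ... | g , i , j , gᵢ≡v , gⱼ≡L with walk-≤ g i j
  ...   | n , n≤2m+2 , w =
    walk⇒near (subst₂ (Walk n) gᵢ≡v gⱼ≡L w) m (ℕₚ.≤-trans n≤2m+2 (ℕₚ.≤-reflexive (2*suc m)))

  -- Exact distances from v: 2k for PointAt k, 2k + 1 for LineAt k, and n for At n.
  PointAt : ℕ → Fin np → Set
  PointAt k x = Least {P = λ j → Within j x} k

  LineAt : ℕ → Fin nl → Set
  LineAt k L = Least {P = λ j → LineWithin j L} k

  At : ℕ → Elem Γ → Set
  At n (inj₁ x) = ∃ λ k → n ≡ k + k × PointAt k x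
  At n (inj₂ L) = ∃ λ k → n ≡ suc (k + k) × LineAt k L

  At-unique : ∀ {n n′ e} → At n e → At n′ e → n ≡ n′
  At-unique {e = inj₁ _} (k , n≡2k , x-at) (k′ , n′≡2k′ , x-at′) =
    trans n≡2k (trans (cong (λ z → z + z) (least-unique x-at x-at′)) (sym n′≡2k′))
  At-unique {e = inj₂ _} (k , n≡2k+1 , L-at) (k′ , n′≡2k′+1 , L-at′) =
    trans n≡2k+1 (trans (cong (λ z → suc (z + z)) (least-unique L-at L-at′)) (sym n′≡2k′+1))

  At-zero : ∀ {e} → At 0 e → e ≡ inj₁ v
  At-zero {inj₁ x} (zero  , _  , x-within , _) = cong inj₁ (sym (within-zero⁻ x-within))
  At-zero {inj₁ x} (suc k , () , _)
  At-zero {inj₂ L} (k     , () , _)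

  At-pred : ∀ {n e} → At (suc n) e → ∃ λ e′ → Adj Γ e′ e × At n e′
  At-pred {e = inj₁ x} (zero , () , _)
  At-pred {e = inj₁ x} (suc k , n+1≡2k+2 , x-within , x-below) with within-suc⁻ {k} x-within
  ... | inj₁ x-within-k = ⊥-elim (x-below (ℕₚ.n<1+n k) x-within-k)
  ... | inj₂ (L , x∈L , L-within) =
    inj₂ L , x∈L , k , trans (ℕₚ.suc-injective n+1≡2k+2) (ℕₚ.+-suc k k) , L-within ,
    λ {j} j<k L-within-j → x-below (s≤s j<k) (within-step j x∈L L-within-j)
  At-pred {e = inj₂ L} (k , n+1≡2k+1 , (y , y∈L , y-within) , L-below) =
    inj₁ y , y∈L , k , ℕₚ.suc-injective n+1≡2k+1 , y-within ,
    λ {j} j<k y-within-j → L-below j<k (y , y∈L , y-within-j)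

  -- Fork n r a b: geodesics of length r from a and from b (both at distance n from v) down to a
  -- common element, disjoint apart from it.
  data Fork : ℕ → ℕ → Elem Γ → Elem Γ → Set where
    root : ∀ {n a} → At n a → Fork n 0 a a
    grow : ∀ {n r a′ b′ a b} → Fork n r a′ b′ → Adj Γ a′ a → Adj Γ b′ b →
           At (suc n) a → At (suc n) b → a ≢ b → Fork (suc n) (suc r) a b

  swap : ∀ {n r a b} → Fork n r a b → Fork n r b a
  swap (root a-at)                    = root a-at
  swap (grow F a′a b′b a-at b-at a≢b) = grow (swap F) b′b a′a b-at a-at (a≢b ∘ sym)

  -- left F i for i ≤ r is the element i steps down from a; larger i give junk.
  left right : ∀ {n r a b} → Fork n r a b → ℕ → Elem Γ
  left {a = a} _          zero    = a
  left (root {a = a} _)   (suc _) = a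
  left (grow F _ _ _ _ _) (suc i) = left F i
  right F = left (swap F)

  depth≤level : ∀ {n r a b} → Fork n r a b → r ≤ n
  depth≤level (root _)           = z≤n
  depth≤level (grow F _ _ _ _ _) = s≤s (depth≤level F)

  left-adj : ∀ {n r a b} (F : Fork n r a b) {i} → i < r → Adj Γ (left F (suc i)) (left F i)
  left-adj (grow _ a′a _ _ _ _) {zero}  _         = a′a
  left-adj (grow F _ _ _ _ _)   {suc i} (s≤s i<r) = left-adj F i<r

  left-at : ∀ {n r a b} (F : Fork n r a b) {i} → i ≤ r → At (n ∸ i) (left F i)
  left-at (root a-at)           z≤n               = a-at
  left-at (grow _ _ _ a-at _ _) {zero}  _         = a-at
  left-at (grow F _ _ _ _ _)    {suc i} (s≤s i≤r) = left-at F i≤r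

  left-meets-right : ∀ {n r a b} (F : Fork n r a b) → left F r ≡ right F r
  left-meets-right (root _)           = refl
  left-meets-right (grow F _ _ _ _ _) = left-meets-right F

  left-apart-right : ∀ {n r a b} (F : Fork n r a b) {i} → i < r → left F i ≢ right F i
  left-apart-right (grow _ _ _ _ _ a≢b) {zero}  _         = a≢b
  left-apart-right (grow F _ _ _ _ _)   {suc i} (s≤s i<r) = left-apart-right F i<r

  fork : ∀ n {a b} → a ≢ b → At n a → At n b → ∃ λ r → Fork n (suc r) a b
  fork zero    a≢b a-at b-at = ⊥-elim (a≢b (trans (At-zero a-at) (sym (At-zero b-at))))
  fork (suc n) a≢b a-at b-at with At-pred a-at | At-pred b-at
  ... | a′ , a′a , a′-at | b′ , b′b , b′-at with ≡-dec Finₚ._≟_ Finₚ._≟_ a′ b′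
  ...   | yes refl = 0 , grow (root a′-at) a′a b′b a-at b-at a≢b
  ...   | no a′≢b′ with fork n a′≢b′ a′-at b′-at
  ...     | r , F = suc r , grow F a′a b′b a-at b-at a≢b

  -- The closed walk c, left 0, …, left D = right D, right (D - 1), …, right 0, c.  Its vertices are
  -- told apart by their distance from v, except left i and right i, which differ for i < D.
  module ForkCycle {n r a b c} (F : Fork n (suc r) a b) (c-at : At (suc n) c)
                   (ac : Adj Γ a c) (bc : Adj Γ b c) where

    D : ℕ
    D = suc r

    vertex : ℕ → Elem Γ
    vertex zero = c
    vertex (suc p) with p ≤? D
    ... | yes _ = left F p
    ... | no  _ = right F (D + D ∸ p)

    vertex-left : ∀ {i} → i ≤ D → vertex (suc i) ≡ left F i
    vertex-left {i} i≤D with i ≤? D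
    ... | yes _   = refl
    ... | no  i≰D = ⊥-elim (i≰D i≤D)

    vertex-right : ∀ {p} → D < p → vertex (suc p) ≡ right F (D + D ∸ p)
    vertex-right {p} D<p with p ≤? D
    ... | yes p≤D = ⊥-elim (ℕₚ.<⇒≱ D<p p≤D)
    ... | no  _   = refl

    mirror-< : ∀ {p} → D < p → p ≤ D + D → D + D ∸ p < D
    mirror-< {p} D<p p≤2D = subst (D + D ∸ p <_) (ℕₚ.m+n∸n≡m D D) (ℕₚ.∸-monoʳ-< D<p p≤2D)

    data Position : ℕ → Set where
      apex     : Position 0
      on-left  : ∀ {i} → i ≤ D → Position (suc i)
      on-right : ∀ {i} → i < D → Position (suc (D + D ∸ i))

    position : ∀ {p} → p < suc (suc (D + D)) → Position p
    position {zero}  _ = apex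
    position {suc p} p+1<M with p ≤? D
    ... | yes p≤D = on-left p≤D
    ... | no  p≰D = subst Position (cong suc (ℕₚ.m∸[m∸n]≡n p≤2D)) (on-right (mirror-< D<p p≤2D))
      where
        D<p : D < p
        D<p = ℕₚ.≰⇒> p≰D
        p≤2D : p ≤ D + D
        p≤2D = s≤s⁻¹ (s≤s⁻¹ p+1<M)

    vertex-on-right : ∀ {i} → i < D → vertex (suc (D + D ∸ i)) ≡ right F i
    vertex-on-right {i} i<D =
      trans (vertex-right (subst (D <_) (sym (ℕₚ.+-∸-assoc D (ℕₚ.<⇒≤ i<D))) D<D+[D∸i]))
            (cong (right F) (ℕₚ.m∸[m∸n]≡n (ℕₚ.≤-trans (ℕₚ.<⇒≤ i<D) (ℕₚ.m≤m+n D D))))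
      where
        D<D+[D∸i] : D < D + (D ∸ i)
        D<D+[D∸i] = ℕₚ.m<m+n D (ℕₚ.m<n⇒0<n∸m i<D)

    level : ∀ {p} → Position p → ℕ
    level apex             = suc n
    level (on-left  {i} _) = n ∸ i
    level (on-right {i} _) = n ∸ i

    vertex-at : ∀ {p} (P : Position p) → At (level P) (vertex p)
    vertex-at apex           = c-at
    vertex-at (on-left i≤D)  = subst (At _) (sym (vertex-left i≤D)) (left-at F i≤D)
    vertex-at (on-right i<D) =
      subst (At _) (sym (vertex-on-right i<D)) (left-at (swap F) (ℕₚ.<⇒≤ i<D))

    index-injective : ∀ {i j} → i ≤ D → j ≤ D → n ∸ i ≡ n ∸ j → i ≡ j
    index-injective i≤D j≤D = ℕₚ.∸-cancelˡ-≡ (ℕₚ.≤-trans i≤D D≤n) (ℕₚ.≤-trans j≤D D≤n)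
      where
        D≤n : D ≤ n
        D≤n = depth≤level F

    below-apex : ∀ i → suc n ≢ n ∸ i
    below-apex i 1+n≡n∸i = ℕₚ.m≮m∸n n i (ℕₚ.≤-reflexive 1+n≡n∸i)

    position-injective : ∀ {p q} (P : Position p) (Q : Position q) → vertex p ≡ vertex q → p ≡ q
    position-injective P Q eq =
      by-level P Q eq (At-unique (vertex-at P) (subst (At (level Q)) (sym eq) (vertex-at Q)))
      where
        by-level : ∀ {p q} (P : Position p) (Q : Position q) →
                   vertex p ≡ vertex q → level P ≡ level Q → p ≡ q
        by-level apex             apex             _ _  = refl
        by-level apex             (on-left  {i} _) _ eq = ⊥-elim (below-apex i eq)
        by-level apex             (on-right {i} _) _ eq = ⊥-elim (below-apex i eq)
        by-level (on-left  {i} _) apex             _ eq = ⊥-elim (below-apex i (sym eq))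
        by-level (on-right {i} _) apex             _ eq = ⊥-elim (below-apex i (sym eq))
        by-level (on-left i≤D)    (on-left j≤D)    _ eq = cong suc (index-injective i≤D j≤D eq)
        by-level (on-right i<D)   (on-right j<D)   _ eq =
          cong (λ i → suc (D + D ∸ i)) (index-injective (ℕₚ.<⇒≤ i<D) (ℕₚ.<⇒≤ j<D) eq)
        by-level (on-left i≤D)    (on-right j<D)   eq i≡j
          with index-injective i≤D (ℕₚ.<⇒≤ j<D) i≡j
        ... | refl = ⊥-elim (left-apart-right F j<D
                       (trans (sym (vertex-left i≤D)) (trans eq (vertex-on-right j<D))))
        by-level (on-right i<D)   (on-left j≤D)    eq i≡j
          with index-injective (ℕₚ.<⇒≤ i<D) j≤D i≡j
        ... | refl = ⊥-elim (left-apart-right F i<D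
                       (trans (sym (vertex-left j≤D)) (trans (sym eq) (vertex-on-right i<D))))

    vertex-adj : ∀ {p} → suc p < suc (suc (D + D)) → Adj Γ (vertex p) (vertex (suc p))
    vertex-adj {zero} _ = subst (Adj Γ c) (sym (vertex-left z≤n)) (Adj-sym ac)
    vertex-adj {suc p} p+2<M with ℕₚ.<-cmp p D
    ... | tri< p<D _ _ =
      subst₂ (Adj Γ) (sym (vertex-left (ℕₚ.<⇒≤ p<D))) (sym (vertex-left p<D))
             (Adj-sym (left-adj F p<D))
    ... | tri≈ _ refl _ =
      subst₂ (Adj Γ) (sym (trans (vertex-left ℕₚ.≤-refl) (left-meets-right F)))
             (sym (trans (vertex-right (ℕₚ.n<1+n D)) (cong (right F) (ℕₚ.m+n∸n≡m r D))))
             (left-adj (swap F) ℕₚ.≤-refl)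
    ... | tri> _ _ D<p =
      subst₂ (Adj Γ) (sym (trans (vertex-right D<p) (cong (right F) 2D∸p≡1+j)))
             (sym (vertex-right (ℕₚ.m<n⇒m<1+n D<p)))
             (left-adj (swap F) j<D)
      where
        p+1≤2D : suc p ≤ D + D
        p+1≤2D = s≤s⁻¹ (s≤s⁻¹ p+2<M)
        p≤2D : p ≤ D + D
        p≤2D = ℕₚ.<⇒≤ p+1≤2D
        2D∸p≡1+j : D + D ∸ p ≡ suc (D + D ∸ suc p)
        2D∸p≡1+j = ℕₚ.+-∸-assoc 1 p+1≤2D
        j<D : D + D ∸ suc p < D
        j<D = ℕₚ.<-trans (ℕₚ.n<1+n _) (subst (_< D) 2D∸p≡1+j (mirror-< D<p p≤2D))

    vertex-closes : ∀ {p} → suc p ≡ suc (suc (D + D)) → Adj Γ (vertex p) (vertex 0)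
    vertex-closes refl =
      subst (λ z → Adj Γ z c)
            (sym (trans (vertex-right (ℕₚ.m<m+n D (s≤s z≤n))) (cong (right F) (ℕₚ.n∸n≡0 (D + D)))))
            bc

    gon : OrdinaryGon Γ (suc D)
    gon = ordinaryGon (suc D) vertex
      (λ p<M q<M → position-injective (position (bound p<M)) (position (bound q<M)))
      (λ p+1<M → vertex-adj (bound p+1<M))
      (λ p+1≡M → vertex-closes (trans p+1≡M (2*suc D)))
      where
        bound : ∀ {p} → p < 2 * suc D → p < suc (suc (D + D))
        bound {p} = subst (p <_) (2*suc D)

  pointAt-on-line : ∀ {k L z} → LineAt k L → I z L ≡ true → Within k z → PointAt k z
  pointAt-on-line (_ , L-below) z∈L z-within =
    z-within , λ j<k z-within-j → L-below j<k (_ , z∈L , z-within-j)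

  closest-point-unique : ∀ {m k L x y} → IsWeakGenPolygon Γ (2 * m) → k < m → LineAt k L →
    I x L ≡ true → I y L ≡ true → Within k x → Within k y → x ≡ y
  closest-point-unique {m} {k} {L} {x} {y} polygon k<m L-at x∈L y∈L x-within y-within
    with x Finₚ.≟ y
  ... | yes x≡y = x≡y
  ... | no  x≢y =
    ⊥-elim (no-short-gon (proj₂ (fork (k + k) (x≢y ∘ inj₁-injective)
                                      (on-L-at x∈L x-within) (on-L-at y∈L y-within))))
    where
      on-L-at : ∀ {z} → I z L ≡ true → Within k z → At (k + k) (inj₁ z)
      on-L-at z∈L z-within = k , refl , pointAt-on-line L-at z∈L z-within

      no-short-gon : ∀ {r} → Fork (k + k) (suc r) (inj₁ x) (inj₁ y) → ⊥
      no-short-gon {r} F = IsWeakGenPolygon.noSmall polygon (suc (suc r)) (s≤s (s≤s z≤n)) short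
                             (ForkCycle.gon {c = inj₂ L} F (k , refl , L-at) x∈L y∈L)
        where
          short : suc (suc r) < 2 * m
          short = ℕₚ.≤-trans (s≤s (s≤s (depth≤level F)))
                             (ℕₚ.≤-trans (ℕₚ.≤-reflexive (sym (2*suc k))) (ℕₚ.*-monoʳ-≤ 2 k<m))

  record Projection (m : ℕ) (L : Fin nl) : Set where
    field
      distance   : ℕ
      distance≤m : distance ≤ m
      point      : Fin np
      point∈L    : I point L ≡ true
      point-at   : PointAt distance point
      others-at  : ∀ {x} → I x L ≡ true → x ≢ point → PointAt (suc distance) x

  projection : ∀ {m} → IsWeakGenPolygon Γ (2 * suc m) → ∀ L → Projection m L
  projection polygon L with least-witness (lineWithin? L) (line-within polygon L)
  ... | k , k≤m , L-at@((p , p∈L , p-within) , _) = record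
    { distance   = k
    ; distance≤m = k≤m
    ; point      = p
    ; point∈L    = p∈L
    ; point-at   = pointAt-on-line L-at p∈L p-within
    ; others-at  = λ x∈L x≢p →
        within-step k x∈L (p , p∈L , p-within) ,
        λ j<k+1 x-within-j → x≢p (closest-point-unique polygon (s≤s k≤m) L-at x∈L p∈L
                                    (within-mono (s≤s⁻¹ j<k+1) x-within-j) p-within)
    }

  atDist2-self : ∀ {k x} → PointAt k x → atDist2 Γ k v x ≡ true
  atDist2-self {zero}  (x-within , _)       = x-within
  atDist2-self {suc k} (x-within , x-below) =
    cong₂ _∧_ x-within (cong not (¬-not (x-below (ℕₚ.n<1+n k))))

  atDist2-other : ∀ {k x} → PointAt k x → ∀ {j} → j ≢ k → atDist2 Γ j v x ≡ false
  atDist2-other {k} {x} (x-within , x-below) {j} j≢k with ℕₚ.<-cmp j k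
  ... | tri≈ _ j≡k _ = ⊥-elim (j≢k j≡k)
  ... | tri< j<k _ _ = below j<k
    where
      below : ∀ {j} → j < k → atDist2 Γ j v x ≡ false
      below {zero}  0<k = ¬-not (x-below 0<k)
      below {suc j} j<k = cong (_∧ not (within Γ j v x)) (¬-not (x-below j<k))
  ... | tri> _ _ k<j = above k<j
    where
      above : ∀ {j} → k < j → atDist2 Γ j v x ≡ false
      above {suc j} k<1+j =
        trans (cong (within Γ (suc j) v x ∧_)
                    (cong not (within-mono {k} {j} (s≤s⁻¹ k<1+j) x-within)))
              (∧-zeroʳ _)

module Inner {c ℓ : Level} (F : CommutativeRing c ℓ) (Γ : Geometry) where
  open CommutativeRing F hiding (refl; sym; trans)
  open Geometry Γ
  open Code F Γ
  open import Algebra.Properties.Semiring.Sum semiring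
    using (sum-cong-≋; sum-remove; ∑-comm; *-distribˡ-sum; *-distribʳ-sum)
  open import Algebra.Properties.Ring ring using (-‿distribˡ-*; +-cancelʳ)
  open import Algebra.Properties.CommutativeSemigroup +-commutativeSemigroup using (x∙yz≈y∙xz)
  open import Relation.Binary.Reasoning.Setoid setoid
  module ≈ = Setoid setoid

  𝕚-true : ∀ {b} → b ≡ true → (if b then 1# else 0#) ≈ 1#
  𝕚-true refl = ≈.refl

  𝕚-false : ∀ {b} → b ≡ false → (if b then 1# else 0#) ≈ 0#
  𝕚-false refl = ≈.refl

  𝕚-*-cong : ∀ {n} (q : Fin n → Bool) x {u u′} → (q x ≡ true → u ≈ u′) → 𝕚 q x * u ≈ 𝕚 q x * u′
  𝕚-*-cong q x u≈u′ with q x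
  ... | true  = *-congˡ (u≈u′ refl)
  ... | false = ≈.trans (zeroˡ _) (≈.sym (zeroˡ _))

  ∑-indicator : ∀ {n} (q : Fin n → Bool) → ∑ (𝕚 q) ≈ ι (count q)
  ∑-indicator {zero}  q = ≈.refl
  ∑-indicator {suc n} q with q Fin.zero
  ... | true  = +-congˡ (∑-indicator (q ∘ Fin.suc))
  ... | false = ≈.trans (+-identityˡ _) (∑-indicator (q ∘ Fin.suc))

  ∑-cong-except : ∀ {n} {f g : Fin n → Carrier} p → (∀ x → x ≢ p → f x ≈ g x) →
                  ∑ f + g p ≈ ∑ g + f p
  ∑-cong-except {suc n} {f} {g} p f≈g = begin
    ∑ f + g p                       ≈⟨ +-congʳ (sum-remove {i = p} f) ⟩
    (f p + ∑ (removeAt f p)) + g p  ≈⟨ +-congʳ (+-congˡ (sum-cong-≋ f≈g-off-p)) ⟩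
    (f p + ∑ (removeAt g p)) + g p  ≈⟨ +-comm _ (g p) ⟩
    g p + (f p + ∑ (removeAt g p))  ≈⟨ +-congˡ (+-comm (f p) _) ⟩
    g p + (∑ (removeAt g p) + f p)  ≈⟨ +-assoc (g p) _ (f p) ⟨
    (g p + ∑ (removeAt g p)) + f p  ≈⟨ +-congʳ (sum-remove {i = p} g) ⟨
    ∑ g + f p                       ∎
    where
      f≈g-off-p : ∀ i → removeAt f p i ≈ removeAt g p i
      f≈g-off-p i = f≈g (punchIn p i) (Finₚ.punchInᵢ≢i p i)

  ∑<-zero : ∀ n {f} → (∀ {k} → k < n → f k ≈ 0#) → ∑< n f ≈ 0#
  ∑<-zero zero    _   = ≈.refl
  ∑<-zero (suc n) f≈0 =
    ≈.trans (+-cong (∑<-zero n (f≈0 ∘ ℕₚ.m<n⇒m<1+n)) (f≈0 (ℕₚ.n<1+n n))) (+-identityʳ 0#)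

  ∑<-single : ∀ {n d f} → d < n → (∀ {k} → k < n → k ≢ d → f k ≈ 0#) → ∑< n f ≈ f d
  ∑<-single {suc n} {d} d<1+n f≈0 with ℕₚ.m≤n⇒m<n∨m≡n (s≤s⁻¹ d<1+n)
  ... | inj₁ d<n  = ≈.trans (+-cong (∑<-single d<n (f≈0 ∘ ℕₚ.m<n⇒m<1+n))
                                    (f≈0 (ℕₚ.n<1+n n) (ℕₚ.>⇒≢ d<n)))
                            (+-identityʳ _)
  ... | inj₂ refl = ≈.trans (+-congʳ (∑<-zero d (λ k<d → f≈0 (ℕₚ.m<n⇒m<1+n k<d) (ℕₚ.<⇒≢ k<d))))
                            (+-identityˡ _)

  ∑<-pow-suc : ∀ a n → ∑< (suc n) (pow a) ≈ 1# + a * ∑< n (pow a)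
  ∑<-pow-suc a zero    =
    ≈.trans (+-identityˡ 1#) (≈.sym (≈.trans (+-congˡ (zeroʳ a)) (+-identityʳ 1#)))
  ∑<-pow-suc a (suc n) = begin
    ∑< (suc n) (pow a) + pow a (suc n)     ≈⟨ +-congʳ (∑<-pow-suc a n) ⟩
    (1# + a * ∑< n (pow a)) + a * pow a n  ≈⟨ +-assoc _ _ _ ⟩
    1# + (a * ∑< n (pow a) + a * pow a n)  ≈⟨ +-congˡ (distribˡ a _ _) ⟨
    1# + a * ∑< (suc n) (pow a)            ∎

  [1+a]w+[1-aw]≈1+w : ∀ a w → (1# + a) * w + (1# + (- a) * w) ≈ 1# + w
  [1+a]w+[1-aw]≈1+w a w = begin
    (1# + a) * w + (1# + (- a) * w)  ≈⟨ +-cong (≈.trans (distribʳ w 1# a) (+-congʳ (*-identityˡ w)))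
                                               (+-congˡ (≈.sym (-‿distribˡ-* a w))) ⟩
    (w + a * w) + (1# + - (a * w))   ≈⟨ +-assoc w _ _ ⟩
    w + (a * w + (1# + - (a * w)))   ≈⟨ +-congˡ (x∙yz≈y∙xz (a * w) 1# _) ⟩
    w + (1# + (a * w + - (a * w)))   ≈⟨ +-congˡ (+-congˡ (-‿inverseʳ (a * w))) ⟩
    w + (1# + 0#)                    ≈⟨ +-congˡ (+-identityʳ 1#) ⟩
    w + 1#                           ≈⟨ +-comm w 1# ⟩
    1# + w                           ∎

  inner-span : ∀ {f} (a : Fin nl → Carrier) → (∀ x → f x ≈ ∑ (λ L → a L * 𝕚L L x)) →
               ∀ h → ⟨ f , h ⟩ ≈ ∑ (λ L → a L * ⟨ 𝕚L L , h ⟩)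
  inner-span {f} a f≈∑ h = begin
    ∑ (λ x → f x * h x)
      ≈⟨ sum-cong-≋ (λ x → *-congʳ (f≈∑ x)) ⟩
    ∑ (λ x → ∑ (λ L → a L * 𝕚L L x) * h x)
      ≈⟨ sum-cong-≋ (λ x → *-distribʳ-sum (h x) (λ L → a L * 𝕚L L x)) ⟩
    ∑ (λ x → ∑ (λ L → (a L * 𝕚L L x) * h x))
      ≈⟨ ∑-comm (λ x L → (a L * 𝕚L L x) * h x) ⟩
    ∑ (λ L → ∑ (λ x → (a L * 𝕚L L x) * h x))
      ≈⟨ sum-cong-≋ (λ L → sum-cong-≋ (λ x → *-assoc (a L) (𝕚L L x) (h x))) ⟩
    ∑ (λ L → ∑ (λ x → a L * (𝕚L L x * h x)))
      ≈⟨ sum-cong-≋ (λ L → *-distribˡ-sum (a L) (λ x → 𝕚L L x * h x)) ⟨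
    ∑ (λ L → a L * ⟨ 𝕚L L , h ⟩)
      ∎

  module Weights (m s : ℕ) where

    weight : ℕ → Carrier
    weight d = ∑< (m ∸ d) (pow (- ι s))

    weight-step : ∀ {d} → d < m → weight d ≈ 1# + (- ι s) * weight (suc d)
    weight-step {d} d<m =
      ≈.trans (reflexive (cong (λ n → ∑< n (pow (- ι s))) (ℕₚ.+-∸-assoc 1 d<m)))
              (∑<-pow-suc (- ι s) (m ∸ suc d))

    cvec-term-off : ∀ {v d x k} → Distances.PointAt Γ v d x → k ≢ d →
                    weight k * 𝕚 (atDist2 Γ k v) x ≈ 0#
    cvec-term-off {v} x-at k≢d =
      ≈.trans (*-congˡ (𝕚-false (Distances.atDist2-other Γ v x-at k≢d))) (zeroʳ _)

    cvec-at : ∀ {v d x} → Distances.PointAt Γ v d x → cvec m s v x ≈ weight d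
    cvec-at {v} {d} {x} x-at with d ℕ.<? m
    ... | yes d<m = begin
      cvec m s v x                    ≈⟨ ∑<-single d<m (λ {k} _ → cvec-term-off {k = k} x-at) ⟩
      weight d * 𝕚 (atDist2 Γ d v) x  ≈⟨ *-congˡ (𝕚-true (Distances.atDist2-self Γ v x-at)) ⟩
      weight d * 1#                   ≈⟨ *-identityʳ _ ⟩
      weight d                        ∎
    ... | no  d≮m = begin
      cvec m s v x  ≈⟨ ∑<-zero m (λ {k} k<m → cvec-term-off {k = k} x-at λ { refl → d≮m k<m }) ⟩
      0#            ≡⟨ cong (λ n → ∑< n (pow (- ι s))) (ℕₚ.m≤n⇒m∸n≡0 (ℕₚ.≮⇒≥ d≮m)) ⟨
      weight d      ∎

  module _ {m s} (polygon : IsWeakGenPolygon Γ (2 ℕ.* suc m))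
           (line-size : ∀ L → count (λ x → I x L) ≡ suc s) (v : Fin np) where
    open Weights (suc m) s
    open Distances Γ v using (projection; module Projection)

    line-inner-cvec : ∀ L → ⟨ 𝕚L L , cvec (suc m) s v ⟩ ≈ 1#
    line-inner-cvec L = +-cancelʳ w′ _ _ (begin
      ⟨ 𝕚L L , cv ⟩ + w′                             ≈⟨ +-congˡ (on-L point∈L) ⟨
      ⟨ 𝕚L L , cv ⟩ + 𝕚L L point * w′               ≈⟨ ∑-cong-except point off-point ⟩
      ∑ (λ x → 𝕚L L x * w′) + 𝕚L L point * cv point  ≈⟨ +-cong (≈.sym (*-distribʳ-sum w′ (𝕚L L)))
                                                               (on-L point∈L) ⟩
      ∑ (𝕚L L) * w′ + cv point                       ≈⟨ +-cong (*-congʳ L-size) (cvec-at point-at) ⟩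
      (1# + ι s) * w′ + weight distance              ≈⟨ +-congˡ (weight-step (s≤s distance≤m)) ⟩
      (1# + ι s) * w′ + (1# + (- ι s) * w′)          ≈⟨ [1+a]w+[1-aw]≈1+w (ι s) w′ ⟩
      1# + w′                                        ∎)
      where
        open Projection (projection polygon L)
        cv : Fin np → Carrier
        cv = cvec (suc m) s v
        w′ : Carrier
        w′ = weight (suc distance)
        on-L : ∀ {x u} → I x L ≡ true → 𝕚L L x * u ≈ u
        on-L x∈L = ≈.trans (*-congʳ (𝕚-true x∈L)) (*-identityˡ _)
        off-point : ∀ x → x ≢ point → 𝕚L L x * cv x ≈ 𝕚L L x * w′
        off-point x x≢p = 𝕚-*-cong (λ y → I y L) x (λ x∈L → cvec-at (others-at x∈L x≢p))
        L-size : ∑ (𝕚L L) ≈ 1# + ι s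
        L-size = ≈.trans (∑-indicator (λ x → I x L)) (reflexive (cong ι (line-size L)))

    code-inner-cvec : ∀ {f} (a : Fin nl → Carrier) → (∀ x → f x ≈ ∑ (λ L → a L * 𝕚L L x)) →
                      ⟨ f , cvec (suc m) s v ⟩ ≈ ∑ a
    code-inner-cvec a f≈∑ =
      ≈.trans (inner-span a f≈∑ _)
              (sum-cong-≋ (λ L → ≈.trans (*-congˡ (line-inner-cvec L)) (*-identityʳ (a L))))

corollary3p5 : ∀ {c ℓ : Level} (F : CommutativeRing c ℓ) → IsField F →
    (Γ : Geometry) (m s t : ℕ) → 2 ≤ m →
    IsWeakGenPolygon Γ (2 Data.Nat.* m) → HasOrder Γ s t →
    let open CommutativeRing F in
    (cw : Fin (Geometry.np Γ) → Carrier) → Code.InCode F Γ cw →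
    (v w : Fin (Geometry.np Γ)) →
    Code.⟨_,_⟩ F Γ cw (Code.cvec F Γ m s v) ≈ Code.⟨_,_⟩ F Γ cw (Code.cvec F Γ m s w)
corollary3p5 F _ Γ (suc m) s t (s≤s _) polygon order cw (a , cw≈∑) v w = begin
  ⟨ cw , cvec (suc m) s v ⟩  ≈⟨ code-inner-cvec polygon (proj₁ order) v a cw≈∑ ⟩
  ∑ a                        ≈⟨ code-inner-cvec polygon (proj₁ order) w a cw≈∑ ⟨
  ⟨ cw , cvec (suc m) s w ⟩  ∎
  where
    open CommutativeRing F using (setoid)
    open Code F Γ
    open Inner F Γ
    open import Relation.Binary.Reasoning.Setoid setoid
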